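{- For any positive integers $q$, $k$ and $t$ there exists a constant $f(q,k,t)$ such that the following holds. Let $D=(V,A)$ be a Steiner rooted $k$-arc-connected directed graph with root $r$ and a set $S\subseteq V\setminus\{r\}$ of $t$ terminals. Let $\mathcal{C}$ be a family of pairwise vertex-disjoint directed cycles of $D$ with $|\mathcal{C}|\ge f(q,k,t)$ such that each $C\in\mathcal{C}$ is $s$-essential for every $s\in S$. Then there exist $C_1,\ldots,C_q\in\mathcal{C}$ such that for every $s\in S$, either $(C_1,\ldots,C_q)$ or $(C_q,\ldots,C_1)$ is an $s$-ordered sequence of directed cycles.
   Context: $D$ is Steiner rooted $k$-arc-connected with root $r$ and terminal set $S$ if for every $s\in S$ there are $k$ pairwise arc-disjoint directed $r$-$s$ paths. For $s\in S$, an $s$-cut is a set $U\subseteq V$ with $r\in U$, $s\notin U$; it is tight if exactly $k$ arcs leave $U$ (have tail in $U$ and head outside $U$). A set $U$ properly intersects a directed cycle $C$ if $V(C)\cap U\neq\emptyset$ and $V(C)\setminus U\neq\emptyset$. A directed cycle $C$ is $s$-essential if some tight $s$-cut properly intersects $C$. A sequence $(C_1,\ldots,C_q)$ of directed cycles is $s$-ordered if there exist tight $s$-cuts $U_1,\ldots,U_q$ with $V(C_i)\subseteq U_j$ for all $i<j$, $V(C_i)\cap U_j=\emptyset$ for all $i>j$, and $U_i$ properly intersecting $C_i$ for every $i$. -}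

module Defs where

open import Data.Nat using (ℕ; _≤_; _<_)
open import Data.Fin as Fin using (Fin; opposite)
open import Data.Fin.Subset using (Subset; _∈_; _∉_; ∣_∣)
open import Data.Fin.Subset.Properties using (_∈?_)
open import Data.List using (List; []; _∷_; map; filter; length; allFin)
open import Data.List.Membership.Propositional renaming (_∈_ to _∈ₗ_; _∉_ to _∉ₗ_)
open import Data.List.Relation.Unary.Unique.Propositional using (Unique)
open import Data.Product using (Σ; ∃; _×_; _,_)
open import Relation.Binary.PropositionalEquality using (_≡_; _≢_)
open import Relation.Nullary using (¬_)
open import Relation.Nullary.Decidable using (_×-dec_; ¬?)

record Digraph : Set where
  field
    n   : ℕ
    m   : ℕ
    tl  : Fin m → Fin n
    hd  : Fin m → Fin n

module _ (D : Digraph) where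
  open Digraph D

  Vertex : Set
  Vertex = Fin n

  Arc : Set
  Arc = Fin m

  data Walk : Vertex → Vertex → List Arc → Set where
    nil  : ∀ {u} → Walk u u []
    cons : ∀ {u v as} (a : Arc) → tl a ≡ u → Walk (hd a) v as → Walk u v (a ∷ as)

  walkVerts : Vertex → List Arc → List Vertex
  walkVerts u as = u ∷ map hd as

  IsPath : Vertex → Vertex → List Arc → Set
  IsPath u v as = Walk u v as × Unique (walkVerts u as)

  SteinerRootedArcConnected : ℕ → Vertex → Subset n → Set
  SteinerRootedArcConnected k r S =
    ∀ s → s ∈ S →
      Σ (Fin k → List Arc) λ P →
        (∀ i → IsPath r s (P i)) ×
        (∀ i j → i ≢ j → ∀ a → a ∈ₗ P i → a ∉ₗ P j)

  IsCycle : List Arc → Set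
  IsCycle c = (c ≢ []) × (∃ λ v → Walk v v c) × Unique (map tl c)

  cycleVerts : List Arc → List Vertex
  cycleVerts c = map tl c

  leaving : Subset n → List Arc
  leaving U = filter (λ a → (tl a ∈? U) ×-dec ¬? (hd a ∈? U)) (allFin m)

  IsSCut : Vertex → Vertex → Subset n → Set
  IsSCut r s U = (r ∈ U) × (s ∉ U)

  IsTightSCut : ℕ → Vertex → Vertex → Subset n → Set
  IsTightSCut k r s U = IsSCut r s U × (length (leaving U) ≡ k)

  ProperlyIntersects : Subset n → List Arc → Set
  ProperlyIntersects U c =
    (∃ λ v → v ∈ₗ cycleVerts c × v ∈ U) × (∃ λ v → v ∈ₗ cycleVerts c × v ∉ U)

  IsEssential : ℕ → Vertex → Vertex → List Arc → Set
  IsEssential k r s c = ∃ λ U → IsTightSCut k r s U × ProperlyIntersects U c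

  VertexDisjoint : List Arc → List Arc → Set
  VertexDisjoint c c' = ∀ v → v ∈ₗ cycleVerts c → v ∉ₗ cycleVerts c'

  IsOrdered : ℕ → Vertex → Vertex → (q : ℕ) → (Fin q → List Arc) → Set
  IsOrdered k r s q C =
    Σ (Fin q → Subset n) λ U →
      (∀ j → IsTightSCut k r s (U j)) ×
      (∀ i j → i Fin.< j → ∀ v → v ∈ₗ cycleVerts (C i) → v ∈ U j) ×
      (∀ i j → j Fin.< i → ∀ v → v ∈ₗ cycleVerts (C i) → v ∉ U j) ×
      (∀ i → ProperlyIntersects (U i) (C i))

  reverseSeq : ∀ {q} → (Fin q → List Arc) → Fin q → List Arc
  reverseSeq C i = C (opposite i)

module Submission where

-- For a terminal s, pick for every cycle Cᵢ a tight s-cut Uᵢ crossing it, and consider the four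
-- relations "Cⱼ ⊆ Uᵢ", "Cⱼ ∩ Uᵢ = ∅" and their transposes. Ramsey's theorem, iterated over these
-- 4t relations, gives q + k cycles on which all of them are homogeneous. Every cycle crossed by a cut
-- contains an arc leaving it, so, the cycles being disjoint, no tight cut crosses more than k of them.
-- Tight s-cuts are closed under ∩ and ∪ (the out-degree is submodular and every s-cut has out-degree
-- at least k), so every homogeneous pattern other than the two orderings yields a tight cut crossing
-- all of the cycles: the first cut, the last cut, the intersection or the union of all cuts.

open import Algebra.Properties.CommutativeSemigroup using (interchange)
open import Data.Bool using (Bool; true; false; not; _∧_; _∨_; if_then_else_)
open import Data.Empty using (⊥; ⊥-elim)
open import Data.Fin as Fin using (Fin; zero; suc; inject≤; opposite)
open import Data.Fin.Properties using (<-cmp; toℕ-inject≤; opposite-prop; toℕ<n; injective⇒≤)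
open import Data.Fin.Subset using (Subset; _∈_; _∉_; ∣_∣; _∩_; _∪_; ⋂; ⋃) renaming (_⊆_ to _⊆ₛ_)
open import Data.Fin.Subset.Properties
  using (_∈?_; ∈⊤; ∉⊥; x∈p∩q⁺; p∩q⊆p; p∩q⊆q; x∈p∪q⁻; p⊆p∪q; q⊆p∪q; ∩-identityʳ; ∪-identityʳ)
open import Data.List using (List; []; _∷_; _++_; length; lookup; filter; map; allFin)
open import Data.List.Properties using (length-map; length-tabulate)
open import Data.List.Membership.Propositional using (find) renaming (_∈_ to _∈ₗ_)
open import Data.List.Membership.Propositional.Properties
  using (∈-lookup; ∈-map⁺; ∈-filter⁺; ∈-allFin; ∈-++⁺ˡ; ∈-++⁺ʳ)
open import Data.List.Relation.Binary.Sublist.Propositional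
  using (_⊆_; []; _∷_; _∷ʳ_; minimum; ⊆-refl; ⊆-trans)
open import Data.List.Relation.Binary.Sublist.Propositional.Properties using (All-resp-⊆; filter-⊆)
open import Data.List.Relation.Unary.All as All using (All; []; _∷_)
open import Data.List.Relation.Unary.All.Properties using (all-filter; ¬All⇒Any¬) renaming (map⁺ to All-map⁺)
open import Data.List.Relation.Unary.AllPairs as AllPairs using (AllPairs; []; _∷_)
open import Data.List.Relation.Unary.Any using (here; there; index)
open import Data.List.Relation.Unary.Any.Properties using (lookup-index)
open import Data.List.Relation.Unary.Unique.Propositional using (Unique)
open import Data.List.Relation.Unary.Unique.Propositional.Properties using (allFin⁺)
open import Data.Nat using (ℕ; zero; suc; _+_; _≤_; _<_; z≤n; s≤s)
open import Data.Nat.Properties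
  using (+-commutativeSemigroup; module ≤-Reasoning; _≤?_; ≤-refl; ≤-reflexive; ≤-trans; ≤-antisym;
         <⇒≤; ≰⇒>; <⇒≱; +-suc; +-mono-≤; +-monoˡ-≤; +-monoʳ-≤; +-cancelˡ-≤; +-cancelʳ-≤; m≤m+n; ∸-monoʳ-<)
open import Data.Product as Product using (Σ; ∃; ∃₂; _×_; _,_; proj₁; proj₂)
open import Data.Sum as Sum using (_⊎_; inj₁; inj₂)
open import Data.Vec as Vec using ([]; _∷_; here; there)
open import Data.Vec.Properties using (lookup-zipWith)
open import Defs
open import Function using (_∘_; flip; id)
open import Function.Definitions using (Injective)
open import Level using (Level; 0ℓ)
open import Relation.Binary using (Rel; Decidable; tri<; tri≈; tri>)
open import Relation.Binary.PropositionalEquality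
open import Relation.Nullary using (¬_; yes; no; does; contradiction)
open import Relation.Nullary.Decidable using (_×-dec_; ¬?; decidable-stable)
import Relation.Unary as U

private variable
  ℓ : Level
  A : Set

Chain : Rel A ℓ → ∀ {q} → (Fin q → A) → Set ℓ
Chain R f = ∀ {i j} → i Fin.< j → R (f i) (f j)

module _ {R : Rel A ℓ} where

  AllPairs-resp-⊆ : ∀ {xs ys} → xs ⊆ ys → AllPairs R ys → AllPairs R xs
  AllPairs-resp-⊆ []          []         = []
  AllPairs-resp-⊆ (_ ∷ʳ τ)    (_ ∷ rys)  = AllPairs-resp-⊆ τ rys
  AllPairs-resp-⊆ (refl ∷ τ)  (rx ∷ rys) = All-resp-⊆ τ rx ∷ AllPairs-resp-⊆ τ rys

  AllPairs⇒Chain-lookup : ∀ {xs} → AllPairs R xs → Chain R (lookup xs)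
  AllPairs⇒Chain-lookup (rx ∷ _)   {zero}  {suc j} _         = All.lookup rx (∈-lookup j)
  AllPairs⇒Chain-lookup (_ ∷ rxs)  {suc i} {suc j} (s≤s i<j) = AllPairs⇒Chain-lookup rxs i<j

  Chain-inject≤ : ∀ {q L} {f : Fin L → A} → Chain R f → (q≤L : q ≤ L) → Chain R (λ i → f (inject≤ i q≤L))
  Chain-inject≤ chain q≤L {i} {j} i<j =
    chain (subst₂ _<_ (sym (toℕ-inject≤ i q≤L)) (sym (toℕ-inject≤ j q≤L)) i<j)

  Chain-opposite : ∀ {q} {f : Fin q → A} → Chain R f → Chain (flip R) (f ∘ opposite)
  Chain-opposite chain {i} {j} i<j = chain opposite-<
    where
    opposite-< : opposite j Fin.< opposite i
    opposite-< rewrite opposite-prop i | opposite-prop j = ∸-monoʳ-< (s≤s i<j) (toℕ<n j)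

  AllPairs-both-ways : ∀ {xs x y} → AllPairs R xs → AllPairs (flip R) xs → x ∈ₗ xs → y ∈ₗ xs → x ≡ y ⊎ R x y
  AllPairs-both-ways _          _          (here refl) (here refl) = inj₁ refl
  AllPairs-both-ways (rx ∷ _)   _          (here refl) (there y∈) = inj₂ (All.lookup rx y∈)
  AllPairs-both-ways _          (rx ∷ _)   (there x∈) (here refl) = inj₂ (All.lookup rx x∈)
  AllPairs-both-ways (_ ∷ rxs)  (_ ∷ rxs′) (there x∈) (there y∈) = AllPairs-both-ways rxs rxs′ x∈ y∈

  AllPairs-last : ∀ {x xs} → AllPairs R (x ∷ xs) → ∃ λ y → y ∈ₗ x ∷ xs × All (λ z → z ≡ y ⊎ R z y) (x ∷ xs)
  AllPairs-last {x} {[]}     _          = x , here refl , inj₁ refl ∷ []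
  AllPairs-last {x} {_ ∷ _} (rx ∷ rxs) with AllPairs-last rxs
  ... | y , y∈ , last = y , there y∈ , inj₂ (All.lookup rx y∈) ∷ last

Chain-≢⇒injective : ∀ {q} {f : Fin q → A} → Chain _≢_ f → Injective _≡_ _≡_ f
Chain-≢⇒injective chain {i} {j} fi≡fj with <-cmp i j
... | tri< i<j _ _ = contradiction fi≡fj (chain i<j)
... | tri≈ _ i≡j _ = i≡j
... | tri> _ _ j<i = contradiction (sym fi≡fj) (chain j<i)

injective⇒≤-length : ∀ {k} {xs : List A} (f : Fin k → A) → Injective _≡_ _≡_ f → (∀ i → f i ∈ₗ xs) → k ≤ length xs
injective⇒≤-length {xs = xs} f f-inj f∈ = injective⇒≤ index-injective
  where
  index-injective : Injective _≡_ _≡_ (index ∘ f∈)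
  index-injective {i} {j} eq = f-inj (begin
    f i                        ≡⟨ lookup-index (f∈ i) ⟩
    lookup xs (index (f∈ i))   ≡⟨ cong (lookup xs) eq ⟩
    lookup xs (index (f∈ j))   ≡⟨ lookup-index (f∈ j) ⟨
    f j                        ∎)
    where open ≡-Reasoning

length-filter-¬? : ∀ {P : U.Pred A ℓ} (P? : U.Decidable P) xs →
                   length (filter P? xs) + length (filter (¬? ∘ P?) xs) ≡ length xs
length-filter-¬? P? []       = refl
length-filter-¬? P? (x ∷ xs) with does (P? x)
... | true  = cong suc (length-filter-¬? P? xs)
... | false = trans (+-suc _ _) (cong suc (length-filter-¬? P? xs))

m+n≤o+p⇒m≤o⊎n≤p : ∀ {m n o p} → m + n ≤ o + p → m ≤ o ⊎ n ≤ p
m+n≤o+p⇒m≤o⊎n≤p {m} {n} {o} {p} m+n≤o+p with m ≤? o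
... | yes m≤o = inj₁ m≤o
... | no  m≰o = inj₂ (+-cancelˡ-≤ o n p (≤-trans (+-monoˡ-≤ n (<⇒≤ (≰⇒> m≰o))) m+n≤o+p))

indicator : Bool → ℕ
indicator b = if b then 1 else 0

length-filter-∷ : ∀ {P : U.Pred A ℓ} (P? : U.Decidable P) x xs →
                  length (filter P? (x ∷ xs)) ≡ indicator (does (P? x)) + length (filter P? xs)
length-filter-∷ P? x xs with does (P? x)
... | true  = refl
... | false = refl

module _ {P₁ P₂ Q₁ Q₂ : U.Pred A ℓ}
         (P₁? : U.Decidable P₁) (P₂? : U.Decidable P₂) (Q₁? : U.Decidable Q₁) (Q₂? : U.Decidable Q₂) where

  private
    count : ∀ {P : U.Pred A ℓ} → U.Decidable P → List A → ℕ
    count P? = length ∘ filter P?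

  count-+-mono : (∀ x → indicator (does (P₁? x)) + indicator (does (P₂? x)) ≤
                        indicator (does (Q₁? x)) + indicator (does (Q₂? x))) →
                 ∀ xs → count P₁? xs + count P₂? xs ≤ count Q₁? xs + count Q₂? xs
  count-+-mono pointwise []       = z≤n
  count-+-mono pointwise (x ∷ xs) = begin
    count P₁? (x ∷ xs) + count P₂? (x ∷ xs)
      ≡⟨ cong₂ _+_ (length-filter-∷ P₁? x xs) (length-filter-∷ P₂? x xs) ⟩
    (indicator (does (P₁? x)) + count P₁? xs) + (indicator (does (P₂? x)) + count P₂? xs)
      ≡⟨ interchange +-commutativeSemigroup (indicator (does (P₁? x))) (count P₁? xs) (indicator (does (P₂? x))) (count P₂? xs) ⟩
    (indicator (does (P₁? x)) + indicator (does (P₂? x))) + (count P₁? xs + count P₂? xs)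
      ≤⟨ +-mono-≤ (pointwise x) (count-+-mono pointwise xs) ⟩
    (indicator (does (Q₁? x)) + indicator (does (Q₂? x))) + (count Q₁? xs + count Q₂? xs)
      ≡⟨ interchange +-commutativeSemigroup (indicator (does (Q₁? x))) (indicator (does (Q₂? x))) (count Q₁? xs) (count Q₂? xs) ⟩
    (indicator (does (Q₁? x)) + count Q₁? xs) + (indicator (does (Q₂? x)) + count Q₂? xs)
      ≡⟨ cong₂ _+_ (length-filter-∷ Q₁? x xs) (length-filter-∷ Q₂? x xs) ⟨
    count Q₁? (x ∷ xs) + count Q₂? (x ∷ xs) ∎
    where open ≤-Reasoning

≤-squeeze : ∀ {k a b} → k ≤ a → k ≤ b → a + b ≤ k + k → a ≡ k × b ≡ k
≤-squeeze {k} {a} {b} k≤a k≤b a+b≤k+k =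
  ≤-antisym (+-cancelʳ-≤ k a k (≤-trans (+-monoʳ-≤ a k≤b) a+b≤k+k)) k≤a ,
  ≤-antisym (+-cancelˡ-≤ k b k (≤-trans (+-monoˡ-≤ b k≤a) a+b≤k+k)) k≤b

LargeSublist : ℕ → (List A → Set ℓ) → List A → Set ℓ
LargeSublist m P xs = ∃ λ ys → ys ⊆ xs × m ≤ length ys × P ys

module _ {P : List A → Set ℓ} {m : ℕ} where

  LargeSublist-weaken : ∀ {xs ys} → xs ⊆ ys → LargeSublist m P xs → LargeSublist m P ys
  LargeSublist-weaken xs⊆ys (zs , zs⊆xs , m≤ , pzs) = zs , ⊆-trans zs⊆xs xs⊆ys , m≤ , pzs

  LargeSublist-map : ∀ {Q : List A → Set ℓ} {xs} → (∀ {ys} → P ys → Q ys) → LargeSublist m P xs → LargeSublist m Q xs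
  LargeSublist-map P⇒Q (ys , ys⊆xs , m≤ , pys) = ys , ys⊆xs , m≤ , P⇒Q pys

LargeSublist-∷ : ∀ {R : Rel A ℓ} {x xs m} (Rx? : U.Decidable (R x)) →
                 LargeSublist m (AllPairs R) (filter Rx? xs) → LargeSublist (suc m) (AllPairs R) (x ∷ xs)
LargeSublist-∷ {xs = xs} Rx? (ys , ys⊆ , m≤ , rys) =
  _ ∷ ys , refl ∷ ⊆-trans ys⊆ (filter-⊆ Rx? xs) , s≤s m≤ , All-resp-⊆ ys⊆ (all-filter Rx? xs) ∷ rys

Homogeneous : Rel A ℓ → List A → Set ℓ
Homogeneous R xs = AllPairs R xs ⊎ AllPairs (λ x y → ¬ R x y) xs

Homogeneous-resp-⊆ : ∀ {R : Rel A ℓ} {xs ys} → xs ⊆ ys → Homogeneous R ys → Homogeneous R xs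
Homogeneous-resp-⊆ xs⊆ys = Sum.map (AllPairs-resp-⊆ xs⊆ys) (AllPairs-resp-⊆ xs⊆ys)

ramseyBound : ℕ → ℕ → ℕ
ramseyBound zero    _       = 0
ramseyBound (suc _) zero    = 0
ramseyBound (suc a) (suc b) = suc (ramseyBound a (suc b) + ramseyBound (suc a) b)

module _ {R : Rel A ℓ} (R? : Decidable R) where

  ramsey : ∀ a b xs → ramseyBound a b ≤ length xs →
           LargeSublist a (AllPairs R) xs ⊎ LargeSublist b (AllPairs (λ x y → ¬ R x y)) xs
  ramsey zero    _       xs _ = inj₁ ([] , minimum xs , z≤n , [])
  ramsey (suc a) zero    xs _ = inj₂ ([] , minimum xs , z≤n , [])
  ramsey (suc a) (suc b) (x ∷ xs) (s≤s bound)
    with m+n≤o+p⇒m≤o⊎n≤p (≤-trans bound (≤-reflexive (sym (length-filter-¬? (R? x) xs))))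
  ... | inj₁ enough-related =
    Sum.map (LargeSublist-∷ (R? x)) (LargeSublist-weaken (x ∷ʳ filter-⊆ (R? x) xs))
            (ramsey a (suc b) (filter (R? x) xs) enough-related)
  ... | inj₂ enough-unrelated =
    Sum.map (LargeSublist-weaken (x ∷ʳ filter-⊆ (¬? ∘ R? x) xs)) (LargeSublist-∷ (¬? ∘ R? x))
            (ramsey (suc a) b (filter (¬? ∘ R? x) xs) enough-unrelated)

  ramsey-homogeneous : ∀ m xs → ramseyBound m m ≤ length xs → LargeSublist m (Homogeneous R) xs
  ramsey-homogeneous m xs bound =
    Sum.[ LargeSublist-map inj₁ , LargeSublist-map inj₂ ] (ramsey m m xs bound)

iterate : (ℕ → ℕ) → ℕ → ℕ → ℕ
iterate g zero    = id
iterate g (suc n) = g ∘ iterate g n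

module _ {j} {J : Set j} (P : J → List A → Set ℓ)
         (P-resp-⊆ : ∀ {i xs ys} → xs ⊆ ys → P i ys → P i xs)
         (g : ℕ → ℕ) (refine : ∀ i m xs → g m ≤ length xs → LargeSublist m (P i) xs) where

  refine-all : ∀ is m xs → iterate g (length is) m ≤ length xs →
               LargeSublist m (λ ys → All (λ i → P i ys) is) xs
  refine-all []       m xs bound = xs , ⊆-refl , bound , []
  refine-all (i ∷ is) m xs bound with refine i _ xs bound
  ... | ys , ys⊆xs , large , pys with refine-all is m ys large
  ...   | zs , zs⊆ys , m≤ , pzs = zs , ⊆-trans zs⊆ys ys⊆xs , m≤ , P-resp-⊆ zs⊆ys pys ∷ pzs

DecRel : Set → Set₁
DecRel A = Σ (Rel A 0ℓ) Decidable

diagonalRamseyBound : ℕ → ℕ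
diagonalRamseyBound m = ramseyBound m m

ramsey-many : (Rs : List (DecRel A)) → ∀ m xs → iterate diagonalRamseyBound (length Rs) m ≤ length xs →
              LargeSublist m (λ ys → All (λ R → Homogeneous (proj₁ R) ys) Rs) xs
ramsey-many = refine-all (Homogeneous ∘ proj₁) Homogeneous-resp-⊆ diagonalRamseyBound
                         (λ (_ , R?) → ramsey-homogeneous R?)

does-∈? : ∀ {n} (x : Fin n) p → does (x ∈? p) ≡ Vec.lookup p x
does-∈? zero    (true  ∷ _) = refl
does-∈? zero    (false ∷ _) = refl
does-∈? (suc x) (_ ∷ p)     = does-∈? x p

module _ {n : ℕ} where

  ∈-⋂ : ∀ {x : Fin n} {Xs} → All (x ∈_) Xs → x ∈ ⋂ Xs
  ∈-⋂ []           = ∈⊤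
  ∈-⋂ (x∈X ∷ x∈Xs) = x∈p∩q⁺ (x∈X , ∈-⋂ x∈Xs)

  ⋂-⊆ : ∀ {X : Subset n} {Xs} → X ∈ₗ Xs → ⋂ Xs ⊆ₛ X
  ⋂-⊆ {Xs = X ∷ Xs} (here refl) = p∩q⊆p X (⋂ Xs)
  ⋂-⊆ {Xs = Y ∷ Xs} (there X∈)  = ⋂-⊆ X∈ ∘ p∩q⊆q Y (⋂ Xs)

  ∉-⋃ : ∀ {x : Fin n} {Xs} → All (x ∉_) Xs → x ∉ ⋃ Xs
  ∉-⋃ []                         = ∉⊥
  ∉-⋃ {Xs = X ∷ Xs} (x∉X ∷ x∉Xs) = Sum.[ x∉X , ∉-⋃ x∉Xs ] ∘ x∈p∪q⁻ X (⋃ Xs)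

  ⊆-⋃ : ∀ {X : Subset n} {Xs} → X ∈ₗ Xs → X ⊆ₛ ⋃ Xs
  ⊆-⋃ {Xs = X ∷ Xs} (here refl) = p⊆p∪q (⋃ Xs)
  ⊆-⋃ {Xs = Y ∷ Xs} (there X∈)  = q⊆p∪q Y (⋃ Xs) ∘ ⊆-⋃ X∈

Member : ∀ {n} → Subset n → Set
Member {n} S = Σ (Fin n) (_∈ S)

members : ∀ {n} (S : Subset n) → List (Member S)
members []          = []
members (true  ∷ S) = (zero , here) ∷ map (Product.map suc there) (members S)
members (false ∷ S) = map (Product.map suc there) (members S)

length-members : ∀ {n} (S : Subset n) → length (members S) ≡ ∣ S ∣
length-members []          = refl
length-members (true  ∷ S) = cong suc (trans (length-map _ (members S)) (length-members S))
length-members (false ∷ S) = trans (length-map _ (members S)) (length-members S)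

∈-members : ∀ {n s} {S : Subset n} (s∈S : s ∈ S) → (s , s∈S) ∈ₗ members S
∈-members {S = true  ∷ S} here        = here refl
∈-members {S = true  ∷ S} (there s∈S) = there (∈-map⁺ (Product.map suc there) (∈-members s∈S))
∈-members {S = false ∷ S} (there s∈S) = ∈-map⁺ (Product.map suc there) (∈-members s∈S)

leaves-submodularᵇ : ∀ tX tY hX hY →
  indicator ((tX ∧ tY) ∧ not (hX ∧ hY)) + indicator ((tX ∨ tY) ∧ not (hX ∨ hY)) ≤
  indicator (tX ∧ not hX) + indicator (tY ∧ not hY)
leaves-submodularᵇ false false _     _     = z≤n
leaves-submodularᵇ true  true  true  true  = z≤n
leaves-submodularᵇ true  true  true  false = s≤s z≤n
leaves-submodularᵇ true  true  false true  = s≤s z≤n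
leaves-submodularᵇ true  true  false false = s≤s (s≤s z≤n)
leaves-submodularᵇ true  false true  _     = z≤n
leaves-submodularᵇ true  false false true  = z≤n
leaves-submodularᵇ true  false false false = s≤s z≤n
leaves-submodularᵇ false true  true  _     = z≤n
leaves-submodularᵇ false true  false _     = ≤-refl

module _ (D : Digraph) where
  open Digraph D

  ArcDisjointPaths : ℕ → Vertex D → Vertex D → Set
  ArcDisjointPaths k r s =
    Σ (Fin k → List (Arc D)) λ P →
      (∀ i → IsPath D r s (P i)) × (∀ i j → i ≢ j → ∀ a → a ∈ₗ P i → ¬ a ∈ₗ P j)

  outDegree : Subset n → ℕ
  outDegree U = length (leaving D U)

  leaves? : (U : Subset n) → U.Decidable (λ a → tl a ∈ U × hd a ∉ U)
  leaves? U a = (tl a ∈? U) ×-dec ¬? (hd a ∈? U)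

  ∈-leaving : ∀ {U a} → tl a ∈ U → hd a ∉ U → a ∈ₗ leaving D U
  ∈-leaving {U} {a} tl∈U hd∉U = ∈-filter⁺ (leaves? U) (∈-allFin a) (tl∈U , hd∉U)

  outDegree-submodular : ∀ X Y → outDegree (X ∩ Y) + outDegree (X ∪ Y) ≤ outDegree X + outDegree Y
  outDegree-submodular X Y =
    count-+-mono (leaves? (X ∩ Y)) (leaves? (X ∪ Y)) (leaves? X) (leaves? Y) arcwise (allFin m)
    where
    arcwise : ∀ a → indicator (does (leaves? (X ∩ Y) a)) + indicator (does (leaves? (X ∪ Y) a)) ≤
                    indicator (does (leaves? X a)) + indicator (does (leaves? Y a))
    arcwise a
      rewrite does-∈? (tl a) (X ∩ Y) | does-∈? (hd a) (X ∩ Y) | does-∈? (tl a) (X ∪ Y) | does-∈? (hd a) (X ∪ Y)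
            | does-∈? (tl a) X | does-∈? (hd a) X | does-∈? (tl a) Y | does-∈? (hd a) Y
            | lookup-zipWith _∧_ (tl a) X Y | lookup-zipWith _∧_ (hd a) X Y
            | lookup-zipWith _∨_ (tl a) X Y | lookup-zipWith _∨_ (hd a) X Y
      = leaves-submodularᵇ (Vec.lookup X (tl a)) (Vec.lookup Y (tl a)) (Vec.lookup X (hd a)) (Vec.lookup Y (hd a))

  walk-leaves : ∀ {X u w as} → Walk D u w as → u ∈ X → w ∉ X → ∃ λ a → a ∈ₗ as × a ∈ₗ leaving D X
  walk-leaves nil u∈X u∉X = contradiction u∈X u∉X
  walk-leaves {X} (cons a refl walk) tl∈X w∉X with hd a ∈? X
  ... | yes hd∈X = Product.map₂ (Product.map₁ there) (walk-leaves walk hd∈X w∉X)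
  ... | no  hd∉X = a , here refl , ∈-leaving tl∈X hd∉X

  walk-split : ∀ {u w v as} → Walk D u w as → v ∈ₗ map tl as →
               ∃₂ λ bs cs → bs ++ cs ≡ as × Walk D u v bs × Walk D v w cs
  walk-split (cons a refl walk) (here refl) = [] , a ∷ _ , refl , nil , cons a refl walk
  walk-split (cons a refl walk) (there v∈)  with walk-split walk v∈
  ... | bs , cs , refl , walk₁ , walk₂ = a ∷ bs , cs , refl , cons a refl walk₁ , walk₂

  walk-leaves-before : ∀ {X u w v as} → Walk D u w as → u ∈ X → v ∈ₗ map tl as → v ∉ X →
                       ∃ λ a → a ∈ₗ as × a ∈ₗ leaving D X
  walk-leaves-before walk u∈X v∈ v∉X with walk-split walk v∈
  ... | bs , cs , refl , u→v , _ = Product.map₂ (Product.map₁ ∈-++⁺ˡ) (walk-leaves u→v u∈X v∉X)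

  walk-leaves-after : ∀ {X u w v as} → Walk D u w as → v ∈ₗ map tl as → v ∈ X → w ∉ X →
                      ∃ λ a → a ∈ₗ as × a ∈ₗ leaving D X
  walk-leaves-after walk v∈ v∈X w∉X with walk-split walk v∈
  ... | bs , cs , refl , _ , v→w = Product.map₂ (Product.map₁ (∈-++⁺ʳ bs)) (walk-leaves v→w v∈X w∉X)

  cycle-leaves : ∀ {X c} → IsCycle D c → ProperlyIntersects D X c → ∃ λ a → a ∈ₗ c × a ∈ₗ leaving D X
  cycle-leaves {X} (_ , (v , closed) , _) ((x , x∈c , x∈X) , (y , y∈c , y∉X)) with v ∈? X
  ... | yes v∈X = walk-leaves-before closed v∈X y∈c y∉X
  ... | no  v∉X = walk-leaves-after closed x∈c x∈X v∉X

  s-cut-lower-bound : ∀ {k r s X} → ArcDisjointPaths k r s → IsSCut D r s X → k ≤ outDegree X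
  s-cut-lower-bound {X = X} (P , paths , disjoint) (r∈X , s∉X) =
    injective⇒≤-length exit exit-injective (proj₂ ∘ proj₂ ∘ exitOf)
    where
    exitOf : ∀ i → ∃ λ a → a ∈ₗ P i × a ∈ₗ leaving D X
    exitOf i = walk-leaves (proj₁ (paths i)) r∈X s∉X
    exit : Fin _ → Arc D
    exit = proj₁ ∘ exitOf
    exit-injective : Injective _≡_ _≡_ exit
    exit-injective {i} {j} exitᵢ≡exitⱼ = decidable-stable (i Fin.≟ j) λ i≢j →
      disjoint i j i≢j (exit i) (proj₁ (proj₂ (exitOf i)))
        (subst (_∈ₗ P j) (sym exitᵢ≡exitⱼ) (proj₁ (proj₂ (exitOf j))))

  module _ {k r s} (paths : ArcDisjointPaths k r s) where

    tight-uncross : ∀ {X Y} → IsTightSCut D k r s X → IsTightSCut D k r s Y →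
                    IsTightSCut D k r s (X ∩ Y) × IsTightSCut D k r s (X ∪ Y)
    tight-uncross {X} {Y} ((r∈X , s∉X) , dX≡k) ((r∈Y , s∉Y) , dY≡k) =
      (∩-cut , proj₁ squeezed) , (∪-cut , proj₂ squeezed)
      where
      ∩-cut : IsSCut D r s (X ∩ Y)
      ∩-cut = x∈p∩q⁺ (r∈X , r∈Y) , s∉X ∘ p∩q⊆p X Y
      ∪-cut : IsSCut D r s (X ∪ Y)
      ∪-cut = p⊆p∪q Y r∈X , Sum.[ s∉X , s∉Y ] ∘ x∈p∪q⁻ X Y
      squeezed : outDegree (X ∩ Y) ≡ k × outDegree (X ∪ Y) ≡ k
      squeezed = ≤-squeeze (s-cut-lower-bound paths ∩-cut) (s-cut-lower-bound paths ∪-cut)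
                   (≤-trans (outDegree-submodular X Y) (≤-reflexive (cong₂ _+_ dX≡k dY≡k)))

    tight-⋂ : ∀ {X Xs} → All (IsTightSCut D k r s) (X ∷ Xs) → IsTightSCut D k r s (⋂ (X ∷ Xs))
    tight-⋂ (tX ∷ [])       = subst (IsTightSCut D k r s) (sym (∩-identityʳ _)) tX
    tight-⋂ (tX ∷ tY ∷ tYs) = proj₁ (tight-uncross tX (tight-⋂ (tY ∷ tYs)))

    tight-⋃ : ∀ {X Xs} → All (IsTightSCut D k r s) (X ∷ Xs) → IsTightSCut D k r s (⋃ (X ∷ Xs))
    tight-⋃ (tX ∷ [])       = subst (IsTightSCut D k r s) (sym (∪-identityʳ _)) tX
    tight-⋃ (tX ∷ tY ∷ tYs) = proj₂ (tight-uncross tX (tight-⋃ (tY ∷ tYs)))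

  module _ {N} {C : Fin N → List (Arc D)} (cycles : ∀ i → IsCycle D (C i))
           (disjoint : ∀ i j → i ≢ j → VertexDisjoint D (C i) (C j)) where

    crossed-cycles-≤-outDegree : ∀ {W I} → Unique I → (∀ {i} → i ∈ₗ I → ProperlyIntersects D W (C i)) →
                                 length I ≤ outDegree W
    crossed-cycles-≤-outDegree {W} {I} unique crossed =
      injective⇒≤-length exit exit-injective (proj₂ ∘ proj₂ ∘ exitOf)
      where
      exitOf : ∀ p → ∃ λ a → a ∈ₗ C (lookup I p) × a ∈ₗ leaving D W
      exitOf p = cycle-leaves (cycles _) (crossed (∈-lookup p))
      exit : Fin (length I) → Arc D
      exit = proj₁ ∘ exitOf
      exit-injective : Injective _≡_ _≡_ exit
      exit-injective {p} {p′} exitₚ≡exitₚ′ = Chain-≢⇒injective (AllPairs⇒Chain-lookup unique) same-cycle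
        where
        same-cycle : lookup I p ≡ lookup I p′
        same-cycle = decidable-stable (lookup I p Fin.≟ lookup I p′) λ different →
          disjoint _ _ different (tl (exit p)) (∈-map⁺ tl (proj₁ (proj₂ (exitOf p))))
            (subst (λ a → tl a ∈ₗ cycleVerts D (C (lookup I p′))) (sym exitₚ≡exitₚ′)
              (∈-map⁺ tl (proj₁ (proj₂ (exitOf p′)))))

module Crossing (D : Digraph) {k r s} (paths : ArcDisjointPaths D k r s)
  {N} {C : Fin N → List (Arc D)} (cycles : ∀ i → IsCycle D (C i))
  (disjoint : ∀ i j → i ≢ j → VertexDisjoint D (C i) (C j))
  (U : Fin N → Subset (Digraph.n D)) (tight : ∀ i → IsTightSCut D k r s (U i))
  (crosses : ∀ i → ProperlyIntersects D (U i) (C i)) where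

  Inside Outside : Rel (Fin N) 0ℓ
  Inside  i j = All (_∈ U i) (cycleVerts D (C j))
  Outside i j = All (_∉ U i) (cycleVerts D (C j))

  relations : List (DecRel (Fin N))
  relations =
    (Inside , inside?) ∷ (Outside , outside?) ∷ (flip Inside , flip inside?) ∷ (flip Outside , flip outside?) ∷ []
    where
    inside? : Decidable Inside
    inside? i j = All.all? (_∈? U i) _
    outside? : Decidable Outside
    outside? i j = All.all? (λ v → ¬? (v ∈? U i)) _

  neither⇒crosses : ∀ {i j} → ¬ Inside i j → ¬ Outside i j → ProperlyIntersects D (U i) (C j)
  neither⇒crosses {i} ¬inside ¬outside with find (¬All⇒Any¬ (λ v → ¬? (v ∈? U i)) _ ¬outside)
                                          | find (¬All⇒Any¬ (_∈? U i) _ ¬inside)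
  ... | v , v∈ , ¬v∉U | w , w∈ , w∉U = (v , v∈ , decidable-stable (v ∈? U i) ¬v∉U) , (w , w∈ , w∉U)

  crossing-bound : ∀ {W I} → IsTightSCut D k r s W → Unique I → (∀ {i} → i ∈ₗ I → ProperlyIntersects D W (C i)) →
                   length I ≤ k
  crossing-bound (_ , dW≡k) unique crossed =
    ≤-trans (crossed-cycles-≤-outDegree D cycles disjoint unique crossed) (≤-reflexive dW≡k)

  crosses-self-or-neither : ∀ {i j} → j ≡ i ⊎ (¬ Inside i j × ¬ Outside i j) → ProperlyIntersects D (U i) (C j)
  crosses-self-or-neither (inj₁ refl)               = crosses _
  crosses-self-or-neither (inj₂ (¬inside , ¬outside)) = neither⇒crosses ¬inside ¬outside

  first-cut-bound : ∀ {I} → Unique I → AllPairs (λ i j → ¬ Inside i j) I → AllPairs (λ i j → ¬ Outside i j) I →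
                    length I ≤ k
  first-cut-bound {[]}    _      _          _           = z≤n
  first-cut-bound {x ∷ I} unique (¬ins ∷ _) (¬outs ∷ _) =
    crossing-bound (tight x) unique (crosses-self-or-neither ∘ All.lookup first)
    where
    first : All (λ j → j ≡ x ⊎ (¬ Inside x j × ¬ Outside x j)) (x ∷ I)
    first = inj₁ refl ∷ All.map inj₂ (All.zip (¬ins , ¬outs))

  last-cut-bound : ∀ {I} → Unique I → AllPairs (λ i j → ¬ Inside j i) I → AllPairs (λ i j → ¬ Outside j i) I →
                   length I ≤ k
  last-cut-bound {[]}    _      _     _      = z≤n
  last-cut-bound {x ∷ I} unique ¬ins ¬outs with AllPairs-last (AllPairs.zip (¬ins , ¬outs))
  ... | y , _ , last = crossing-bound (tight y) unique (crosses-self-or-neither ∘ All.lookup last)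

  nested-inside-bound : ∀ {I} → Unique I → AllPairs Inside I → AllPairs (flip Inside) I → length I ≤ k
  nested-inside-bound {[]}    _      _      _       = z≤n
  nested-inside-bound {x ∷ I} unique inside inside′ =
    crossing-bound (tight-⋂ D paths (All-map⁺ (All.universal tight (x ∷ I)))) unique crossed
    where
    crossed : ∀ {i} → i ∈ₗ x ∷ I → ProperlyIntersects D (⋂ (map U (x ∷ I))) (C i)
    crossed {i} i∈ with crosses i
    ... | (v , v∈C , v∈U) , (w , w∈C , w∉U) =
      (v , v∈C , ∈-⋂ (All-map⁺ (All.tabulate v∈Uⱼ))) , (w , w∈C , w∉U ∘ ⋂-⊆ (∈-map⁺ U i∈))
      where
      v∈Uⱼ : ∀ {j} → j ∈ₗ x ∷ I → v ∈ U j
      v∈Uⱼ j∈ with AllPairs-both-ways inside inside′ j∈ i∈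
      ... | inj₁ refl     = v∈U
      ... | inj₂ Cᵢ⊆Uⱼ   = All.lookup Cᵢ⊆Uⱼ v∈C

  nested-outside-bound : ∀ {I} → Unique I → AllPairs Outside I → AllPairs (flip Outside) I → length I ≤ k
  nested-outside-bound {[]}    _      _       _        = z≤n
  nested-outside-bound {x ∷ I} unique outside outside′ =
    crossing-bound (tight-⋃ D paths (All-map⁺ (All.universal tight (x ∷ I)))) unique crossed
    where
    crossed : ∀ {i} → i ∈ₗ x ∷ I → ProperlyIntersects D (⋃ (map U (x ∷ I))) (C i)
    crossed {i} i∈ with crosses i
    ... | (v , v∈C , v∈U) , (w , w∈C , w∉U) =
      (v , v∈C , ⊆-⋃ (∈-map⁺ U i∈) v∈U) , (w , w∈C , ∉-⋃ (All-map⁺ (All.tabulate w∉Uⱼ)))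
      where
      w∉Uⱼ : ∀ {j} → j ∈ₗ x ∷ I → w ∉ U j
      w∉Uⱼ j∈ with AllPairs-both-ways outside outside′ j∈ i∈
      ... | inj₁ refl          = w∉U
      ... | inj₂ Cᵢ∩Uⱼ≡∅      = All.lookup Cᵢ∩Uⱼ≡∅ w∈C

  Forward Backward : List (Fin N) → Set
  Forward  I = AllPairs (flip Inside) I × AllPairs Outside I
  Backward I = AllPairs Inside I × AllPairs (flip Outside) I

  forward-or-backward : ∀ {I} → Unique I → k < length I → All (λ R → Homogeneous (proj₁ R) I) relations →
                        Forward I ⊎ Backward I
  forward-or-backward {I} unique long (h₁ ∷ h₂ ∷ h₃ ∷ h₄ ∷ []) = classify h₁ h₂ h₃ h₄
    where
    short : length I ≤ k → ⊥
    short = <⇒≱ long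
    classify : Homogeneous Inside I → Homogeneous Outside I → Homogeneous (flip Inside) I →
               Homogeneous (flip Outside) I → Forward I ⊎ Backward I
    classify (inj₁ ins) _           (inj₁ ins′) _            = ⊥-elim (short (nested-inside-bound unique ins ins′))
    classify (inj₁ ins) _           (inj₂ _)    (inj₁ outs′) = inj₂ (ins , outs′)
    classify (inj₁ _)   _           (inj₂ ¬ins′) (inj₂ ¬outs′) = ⊥-elim (short (last-cut-bound unique ¬ins′ ¬outs′))
    classify (inj₂ ¬ins) (inj₂ ¬outs) _          _            = ⊥-elim (short (first-cut-bound unique ¬ins ¬outs))
    classify (inj₂ _)   (inj₁ outs) _           (inj₁ outs′) = ⊥-elim (short (nested-outside-bound unique outs outs′))
    classify (inj₂ _)   (inj₁ outs) (inj₁ ins′) (inj₂ _)     = inj₁ (ins′ , outs)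
    classify (inj₂ _)   (inj₁ _)    (inj₂ ¬ins′) (inj₂ ¬outs′) = ⊥-elim (short (last-cut-bound unique ¬ins′ ¬outs′))

  ordered : ∀ {q} (τ : Fin q → Fin N) → Chain (flip Inside) τ → Chain Outside τ → IsOrdered D k r s q (C ∘ τ)
  ordered τ earlier-inside later-outside =
    U ∘ τ , tight ∘ τ ,
    (λ i j i<j v v∈ → All.lookup (earlier-inside i<j) v∈) ,
    (λ i j j<i v v∈ → All.lookup (later-outside j<i) v∈) ,
    crosses ∘ τ

ramseyBound⁴ : ℕ → ℕ
ramseyBound⁴ = iterate diagonalRamseyBound 4

module _ (D : Digraph) {k r} {S : Subset (Digraph.n D)} (conn : SteinerRootedArcConnected D k r S)
  {N} {C : Fin N → List (Arc D)} (cycles : ∀ i → IsCycle D (C i))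
  (disjoint : ∀ i j → i ≢ j → VertexDisjoint D (C i) (C j))
  (essential : ∀ i s → s ∈ S → IsEssential D k r s (C i)) where

  module Terminal ((s , s∈S) : Member S) = Crossing D (conn s s∈S) cycles disjoint
    (λ i → proj₁ (essential i s s∈S)) (λ i → proj₁ (proj₂ (essential i s s∈S)))
    (λ i → proj₂ (proj₂ (essential i s s∈S)))

  HomogeneousAt : Member S → List (Fin N) → Set₁
  HomogeneousAt t I = All (λ R → Homogeneous (proj₁ R) I) (Terminal.relations t)

  HomogeneousAtAll : List (Fin N) → Set₁
  HomogeneousAtAll I = All (λ t → HomogeneousAt t I) (members S)

  OrderedSubfamily : ℕ → Set
  OrderedSubfamily q =
    Σ (Fin q → Fin N) λ σ → Injective _≡_ _≡_ σ ×
      (∀ s → s ∈ S → IsOrdered D k r s q (C ∘ σ) ⊎ IsOrdered D k r s q (reverseSeq D (C ∘ σ)))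

  homogeneous-sublist : ∀ m xs → iterate ramseyBound⁴ ∣ S ∣ m ≤ length xs → LargeSublist m HomogeneousAtAll xs
  homogeneous-sublist m xs bound =
    refine-all HomogeneousAt (λ τ → All.map (Homogeneous-resp-⊆ τ)) ramseyBound⁴
               (ramsey-many ∘ Terminal.relations) (members S) m xs
               (subst (λ t → iterate ramseyBound⁴ t m ≤ length xs) (sym (length-members S)) bound)

  homogeneous⇒ordered : ∀ q → 1 ≤ q → LargeSublist (q + k) HomogeneousAtAll (allFin N) → OrderedSubfamily q
  homogeneous⇒ordered q q≥1 (I , I⊆allFin , q+k≤|I| , homogeneous) =
    σ , Chain-≢⇒injective (σ-chain unique) , ordered-at
    where
    q≤|I| : q ≤ length I
    q≤|I| = ≤-trans (m≤m+n q k) q+k≤|I|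
    unique : Unique I
    unique = AllPairs-resp-⊆ I⊆allFin (allFin⁺ N)
    σ : Fin q → Fin N
    σ i = lookup I (inject≤ i q≤|I|)
    σ-chain : ∀ {R : Rel (Fin N) 0ℓ} → AllPairs R I → Chain R σ
    σ-chain {R} all = Chain-inject≤ {R = R} {f = lookup I} (AllPairs⇒Chain-lookup all) q≤|I|
    ordered-at : ∀ s → s ∈ S → IsOrdered D k r s q (C ∘ σ) ⊎ IsOrdered D k r s q (reverseSeq D (C ∘ σ))
    ordered-at s s∈S =
      Sum.map (λ (ins′ , outs) → ordered σ (σ-chain ins′) (σ-chain outs))
              (λ (ins , outs′) → ordered (σ ∘ opposite) (Chain-opposite {R = Inside} (σ-chain ins))
                                                         (Chain-opposite {R = flip Outside} (σ-chain outs′)))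
              (forward-or-backward unique (≤-trans (+-monoˡ-≤ k q≥1) q+k≤|I|)
                                   (All.lookup homogeneous (∈-members s∈S)))
      where open Terminal (s , s∈S)

  ordered-subfamily : ∀ q → 1 ≤ q → iterate ramseyBound⁴ ∣ S ∣ (q + k) ≤ N → OrderedSubfamily q
  ordered-subfamily q q≥1 large =
    homogeneous⇒ordered q q≥1 (homogeneous-sublist (q + k) (allFin N) (subst (_ ≤_) (sym (length-tabulate id)) large))

-- The argument does not use 1 ≤ k, 1 ≤ t or r ∉ S.
proposition2p4 : (q k t : ℕ) → 1 ≤ q → 1 ≤ k → 1 ≤ t →
    Σ ℕ λ f →
      (D : Digraph) (r : Vertex D) (S : Subset (Digraph.n D)) →
      r ∉ S → ∣ S ∣ ≡ t →
      SteinerRootedArcConnected D k r S →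
      (N : ℕ) (𝒞 : Fin N → List (Arc D)) →
      (∀ i → IsCycle D (𝒞 i)) →
      (∀ i j → i ≢ j → VertexDisjoint D (𝒞 i) (𝒞 j)) →
      f ≤ N →
      (∀ i s → s ∈ S → IsEssential D k r s (𝒞 i)) →
      Σ (Fin q → Fin N) λ σ →
        Injective _≡_ _≡_ σ ×
        (∀ s → s ∈ S →
          IsOrdered D k r s q (𝒞 ∘ σ) ⊎ IsOrdered D k r s q (reverseSeq D (𝒞 ∘ σ)))
proposition2p4 q k t q≥1 _ _ =
  iterate ramseyBound⁴ t (q + k) ,
  λ { D r S _ refl conn N 𝒞 cycles disjoint large essential →
        ordered-subfamily D conn cycles disjoint essential q q≥1 large }
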